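{- Let $G$ and $H$ be graphs with $|G|\geq 2$, and suppose $G$ contains a hamiltonian path. If $|G|=2$ and $\|H\|\geq 1$, then $G[H]$ is hamiltonian connected. If $|G|=2k$ for some $k>1$ and $\|H\|\geq 2$, then $G[H]$ is hamiltonian connected.
   Context: The lexicographic product $G[H]$ has vertex set $V(G)\times V(H)$, with $(g,h)(g',h')$ an edge iff $gg'\in E(G)$, or $g=g'$ and $hh'\in E(H)$. $|G|$ is the number of vertices and $\|H\|$ the number of edges. A graph is hamiltonian connected if every two vertices are joined by a hamiltonian path. -}

module Defs where

open import Level using (0ℓ)
open import Data.Nat using (ℕ; suc)
open import Data.Fin using (Fin)
open import Data.Product using (_×_; _,_; Σ; ∃)
open import Data.Sum using (_⊎_)
open import Data.List using (List; []; _∷_; head; last)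
open import Data.Maybe using (just)
open import Data.List.Membership.Propositional using (_∈_)
open import Data.List.Relation.Unary.Unique.Propositional using (Unique)
open import Relation.Binary.PropositionalEquality using (_≡_)
open import Relation.Nullary using (¬_)

record Graph (V : Set) : Set₁ where
  field
    Adj   : V → V → Set
    irrefl : ∀ {x} → ¬ Adj x x
    sym   : ∀ {x y} → Adj x y → Adj y x

open Graph public

FinGraph : ℕ → Set₁
FinGraph n = Graph (Fin n)

lex : ∀ {A B : Set} → Graph A → Graph B → Graph (A × B)
lex G H = record
  { Adj = λ { (g , h) (g' , h') → Adj G g g' ⊎ (g ≡ g' × Adj H h h') }
  ; irrefl = λ { (Data.Sum.inj₁ a) → irrefl G a
               ; (Data.Sum.inj₂ (_ , a)) → irrefl H a }
  ; sym = λ { (Data.Sum.inj₁ a) → Data.Sum.inj₁ (sym G a)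
            ; (Data.Sum.inj₂ (_≡_.refl , a)) → Data.Sum.inj₂ (_≡_.refl , sym H a) }
  }

data Walk {V : Set} (G : Graph V) : List V → Set where
  nil  : Walk G []
  one  : ∀ x → Walk G (x ∷ [])
  cons : ∀ {x y xs} → Adj G x y → Walk G (y ∷ xs) → Walk G (x ∷ y ∷ xs)

IsHamPath : ∀ {V : Set} → Graph V → List V → Set
IsHamPath {V} G p = Walk G p × Unique p × (∀ (v : V) → v ∈ p)

HasHamPath : ∀ {V : Set} → Graph V → Set
HasHamPath G = ∃ λ p → IsHamPath G p

HamConnected : ∀ {V : Set} → Graph V → Set
HamConnected {V} G = ∀ (u v : V) → ¬ u ≡ v →
  ∃ λ p → IsHamPath G p × head p ≡ just u × last p ≡ just v

AtLeast1Edge : ∀ {V : Set} → Graph V → Set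
AtLeast1Edge {V} H = ∃ λ (x : V) → ∃ λ y → Adj H x y

-- ‖H‖ ≥ 2 : H has two distinct edges (as unordered pairs {x,y} ≠ {z,w}).
AtLeast2Edges : ∀ {V : Set} → Graph V → Set
AtLeast2Edges {V} H = ∃ λ (x : V) → ∃ λ y → ∃ λ z → ∃ λ w →
  Adj H x y × Adj H z w ×
  ¬ ((x ≡ z × y ≡ w) ⊎ (x ≡ w × y ≡ z))

-- Let g₀ g₁ … g₂ₖ₋₁ be the hamiltonian path of G and call {gᵢ} × V(H) the i-th layer of G[H]:
-- a copy of H, completely joined to the neighbouring layers. Pair the layers into blocks
-- {2p, 2p+1}; a block is the join H + H, and all of its vertices not prescribed by a construction
-- are swept by zig-zagging between its two layers. A hamiltonian path is assembled block by block,
-- crossing from layer 2p+1 to layer 2p+2. The blocks on one side of the block containing an end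
-- are covered by a loop that leaves that block and returns to the layer it left; inside the block
-- the parity is restored by one step along an edge of H. The blocks on the right are handled by
-- the constructions for the left, applied to the reversed order of the layers. With more than
-- one block some cases need a third vertex of H, and two ends in the inner layer of the first or
-- last block need a second edge. A vertex list is a hamiltonian path exactly when its fibre over
-- every layer is a permutation of V(H); this is the invariant maintained throughout.

module Submission where

open import Defs
open import Data.Nat using (ℕ; zero; suc; _+_; _∸_; _*_; _≤_; _<_; s≤s; z≤n)
open import Data.Nat.Properties
  using (suc-injective; +-comm; +-suc; +-identityʳ; +-cancelˡ-≡; +-∸-assoc; m+n∸n≡m; m∸n≤m; m∸[m∸n]≡n;
         m≤m+n; m≤n+m; m<m+n; n≤1+n; n<1+n; ≤-refl; ≤-reflexive; ≤-trans; <-trans; <-≤-trans; ≤-<-trans;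
         <⇒≤; <⇒≢; ≤⇒≯; ≰⇒>; <-irrefl; <-cmp; _≤?_; m≤n⇒∃[o]m+o≡n)
open import Data.Fin using (Fin; _≟_)
open import Data.Fin.Patterns using (0F)
open import Data.Product using (_×_; _,_; ∃; proj₁; proj₂)
open import Data.Sum using (_⊎_; inj₁; inj₂)
open import Data.Unit using (⊤; tt)
open import Data.Maybe using (Maybe; just; nothing)
open import Data.List using (List; []; _∷_; _++_; map; filter; mapMaybe; reverse; head; last; length; allFin)
open import Data.List.Properties using (unfold-reverse; length-++; length-tabulate; mapMaybe-++; map-++; ++-identityʳ)
import Data.List.Properties as List
open import Data.List.Membership.Propositional using (_∈_; _∉_)
open import Data.List.Membership.Propositional.Properties using (∈-allFin; ∈-filter⁺; ∈-filter⁻; ∈-++⁺ˡ; ∈-++⁺ʳ)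
open import Data.List.Membership.Propositional.Properties.WithK using (unique∧set⇒bag)
open import Data.List.Relation.Binary.BagAndSetEquality using (∼bag⇒↭)
open import Data.List.Relation.Binary.Permutation.Propositional using (_↭_; ↭-trans; ↭-sym; ↭⇒↭ₛ; module PermutationReasoning)
import Data.List.Relation.Binary.Permutation.Setoid.Properties as ↭ₛ
open import Data.List.Relation.Binary.Permutation.Propositional.Properties
  using (∈-resp-↭; ↭-length; ++⁺ˡ; ++-comm; ++-assoc; mapMaybe-↭; shift; shifts; ↭-empty-inv; ↭-reverse)
open import Data.List.Relation.Unary.Any using (here; there)
open import Data.List.Relation.Unary.All using ([]; _∷_)
open import Data.List.Relation.Unary.All.Properties using (¬Any⇒All¬)
open import Data.List.Relation.Unary.AllPairs using ([]; _∷_)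
open import Data.List.Relation.Unary.Unique.Propositional using (Unique)
open import Data.List.Relation.Unary.Unique.Propositional.Properties using (++⁺; filter⁺; allFin⁺; Unique[x∷xs]⇒x∉xs)
open import Function.Bundles using (mk⇔)
open import Relation.Binary using (tri<; tri≈; tri>)
open import Relation.Binary.PropositionalEquality using (_≡_; _≢_; refl; cong; trans; subst; subst₂; ≢-sym)
import Relation.Binary.PropositionalEquality as ≡
open import Relation.Nullary using (¬_; yes; no; contradiction)

data Path {V : Set} (G : Graph V) : V → V → List V → Set where
  stop : ∀ x → Path G x x (x ∷ [])
  step : ∀ {x y z xs} → Adj G x y → Path G y z xs → Path G x z (x ∷ xs)

module _ {V : Set} {G : Graph V} where

  Path⇒Walk : ∀ {x y xs} → Path G x y xs → Walk G xs
  Path⇒Walk (stop x) = one x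
  Path⇒Walk (step e (stop y)) = cons e (one y)
  Path⇒Walk (step e p@(step _ _)) = cons e (Path⇒Walk p)

  Path-head : ∀ {x y xs} → Path G x y xs → head xs ≡ just x
  Path-head (stop x) = refl
  Path-head (step e p) = refl

  Path-last : ∀ {x y xs} → Path G x y xs → last xs ≡ just y
  Path-last (stop x) = refl
  Path-last (step e (stop y)) = refl
  Path-last (step e p@(step _ _)) = Path-last p

  infixr 5 _++⟨_⟩_
  _++⟨_⟩_ : ∀ {x y y' z xs ys} → Path G x y xs → Adj G y y' → Path G y' z ys → Path G x z (xs ++ ys)
  stop x ++⟨ e ⟩ q = step e q
  step e' p ++⟨ e ⟩ q = step e' (p ++⟨ e ⟩ q)

  Path-reverse : ∀ {x y xs} → Path G x y xs → Path G y x (reverse xs)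
  Path-reverse (stop x) = stop x
  Path-reverse {x} (step {xs = xs} e p) rewrite unfold-reverse x xs =
    Path-reverse p ++⟨ sym G e ⟩ stop x

module _ {A : Set} where

  unique-↭ : ∀ {xs ys : List A} → xs ↭ ys → Unique xs → Unique ys
  unique-↭ xs↭ys = ↭ₛ.Unique-resp-↭ (≡.setoid A) (↭⇒↭ₛ xs↭ys)

  unique-insert : ∀ ps {x qs} → x ∉ ps ++ qs → Unique (ps ++ qs) → Unique (ps ++ x ∷ qs)
  unique-insert ps {x} {qs} x∉ u = unique-↭ (↭-sym (shift x ps qs)) (¬Any⇒All¬ _ x∉ ∷ u)

module _ {m : ℕ} where
  open import Data.List.Membership.DecPropositional (_≟_ {m}) using (_∈?_; _∉?_)

  IsEnumeration : List (Fin m) → Set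
  IsEnumeration hs = hs ↭ allFin m

  enumeration⁺ : ∀ {hs} → Unique hs → (∀ h → h ∈ hs) → IsEnumeration hs
  enumeration⁺ u c = ∼bag⇒↭ (unique∧set⇒bag u (allFin⁺ m) (mk⇔ (λ _ → ∈-allFin _) (λ _ → c _)))

  enumeration-complete : ∀ {hs} → IsEnumeration hs → ∀ h → h ∈ hs
  enumeration-complete e h = ∈-resp-↭ (↭-sym e) (∈-allFin h)

  enumeration-length : ∀ {hs} → IsEnumeration hs → length hs ≡ m
  enumeration-length e = trans (↭-length e) (length-tabulate _)

  complement : List (Fin m) → List (Fin m)
  complement hs = filter (_∉? hs) (allFin m)

  ∈-complement⁻ : ∀ {h hs} → h ∈ complement hs → h ∉ hs
  ∈-complement⁻ {hs = hs} p = proj₂ (∈-filter⁻ (_∉? hs) {xs = allFin m} p)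

  ++-complement-enumeration : ∀ {hs} → Unique hs → IsEnumeration (hs ++ complement hs)
  ++-complement-enumeration {hs} u =
    enumeration⁺ (++⁺ u (filter⁺ (_∉? hs) {xs = allFin m} (allFin⁺ m)) (λ (p , q) → ∈-complement⁻ q p)) covered
    where
    covered : ∀ h → h ∈ hs ++ complement hs
    covered h with h ∈? hs
    ... | yes h∈ = ∈-++⁺ˡ h∈
    ... | no h∉ = ∈-++⁺ʳ hs (∈-filter⁺ (_∉? hs) (∈-allFin h) h∉)

  enumeration-unique : ∀ {hs} → IsEnumeration hs → Unique hs
  enumeration-unique e = unique-↭ (↭-sym e) (allFin⁺ m)

  complement-enumeration : ∀ ps qs → Unique (ps ++ qs) → IsEnumeration (ps ++ complement (ps ++ qs) ++ qs)
  complement-enumeration ps qs u = ↭-trans shuffle (++-complement-enumeration u)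
    where
    shuffle : ps ++ complement (ps ++ qs) ++ qs ↭ (ps ++ qs) ++ complement (ps ++ qs)
    shuffle = ↭-trans (++⁺ˡ ps (++-comm (complement (ps ++ qs)) qs)) (↭-sym (++-assoc ps qs _))

  length-complement : ∀ {hs} → Unique hs → length hs + length (complement hs) ≡ m
  length-complement {hs} u = trans (≡.sym (length-++ hs)) (enumeration-length (++-complement-enumeration u))

  unique-length≤ : ∀ {hs} → Unique hs → length hs ≤ m
  unique-length≤ {hs} u = ≡.subst (length hs ≤_) (length-complement u) (m≤m+n _ _)

  fresh : ∀ {hs} → Unique hs → length hs < m → ∃ λ h → h ∉ hs
  fresh {hs} u |hs|<m with complement hs in eq
  ... | h ∷ _ = h , ∈-complement⁻ (≡.subst (h ∈_) (≡.sym eq) (here refl))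
  ... | [] = contradiction |hs|<m (<-irrefl |hs|≡m)
    where
    |hs|≡m : length hs ≡ m
    |hs|≡m = trans (≡.sym (+-identityʳ _)) (≡.subst (λ c → length hs + length c ≡ m) eq (length-complement u))

  CanInsert : ℕ → Set
  CanInsert k = ∀ ps {qs : List (Fin m)} → Unique (ps ++ qs) → length (ps ++ qs) ≡ k → ∃ λ h → Unique (ps ++ h ∷ qs)

  canInsert : ∀ {zs : List (Fin m)} → Unique zs → ∀ {k} → k < length zs → CanInsert k
  canInsert uz k<|zs| ps u refl =
    let (h , h∉) = fresh u (<-≤-trans k<|zs| (unique-length≤ uz)) in h , unique-insert ps h∉ u

  length-complement-cong : ∀ {xs ys : List (Fin m)} → Unique xs → Unique ys → length xs ≡ length ys →
                           length (complement xs) ≡ length (complement ys)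
  length-complement-cong {xs} {ys} ux uy eq =
    +-cancelˡ-≡ (length xs) (length (complement xs)) (length (complement ys)) (begin
      length xs + length (complement xs)  ≡⟨ length-complement ux ⟩
      m                                   ≡⟨ ≡.sym (length-complement uy) ⟩
      length ys + length (complement ys)  ≡⟨ cong (_+ length (complement ys)) (≡.sym eq) ⟩
      length xs + length (complement ys)  ∎)
    where open ≡.≡-Reasoning

unique₁ : ∀ {m} (a : Fin m) → Unique (a ∷ [])
unique₁ a = [] ∷ []

unique₂ : ∀ {m} {a b : Fin m} → a ≢ b → Unique (a ∷ b ∷ [])
unique₂ a≢b = (a≢b ∷ []) ∷ [] ∷ []

unique₃ : ∀ {m} {a b c : Fin m} → a ≢ b → a ≢ c → b ≢ c → Unique (a ∷ b ∷ c ∷ [])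
unique₃ a≢b a≢c b≢c = (a≢b ∷ a≢c ∷ []) ∷ unique₂ b≢c

unique₄ : ∀ {m} {a b c d : Fin m} → a ≢ b → a ≢ c → a ≢ d → b ≢ c → b ≢ d → c ≢ d → Unique (a ∷ b ∷ c ∷ d ∷ [])
unique₄ a≢b a≢c a≢d b≢c b≢d c≢d = (a≢b ∷ a≢c ∷ a≢d ∷ []) ∷ unique₃ b≢c b≢d c≢d

module _ {n m : ℕ} where

  inFibre : Fin n → Fin n × Fin m → Maybe (Fin m)
  inFibre g (g' , h) with g' ≟ g
  ... | yes _ = just h
  ... | no _ = nothing

  fibre : Fin n → List (Fin n × Fin m) → List (Fin m)
  fibre g = mapMaybe (inFibre g)

  fibre-here : ∀ g h vs → fibre g ((g , h) ∷ vs) ≡ h ∷ fibre g vs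
  fibre-here g h vs with g ≟ g
  ... | yes _ = refl
  ... | no g≢g = contradiction refl g≢g

  fibre-elsewhere : ∀ {g g'} h vs → g' ≢ g → fibre g ((g' , h) ∷ vs) ≡ fibre g vs
  fibre-elsewhere {g} {g'} h vs g'≢g with g' ≟ g
  ... | yes g'≡g = contradiction g'≡g g'≢g
  ... | no _ = refl

  fibre-++ : ∀ g us vs → fibre g (us ++ vs) ≡ fibre g us ++ fibre g vs
  fibre-++ g = mapMaybe-++ (inFibre g)

  fibre-↭ : ∀ g {us vs} → us ↭ vs → fibre g us ↭ fibre g vs
  fibre-↭ g = mapMaybe-↭ (inFibre g)

  ∈-fibre⁺ : ∀ {g h} vs → (g , h) ∈ vs → h ∈ fibre g vs
  ∈-fibre⁺ {g} ((g' , h') ∷ vs) (here refl) rewrite fibre-here g h' vs = here refl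
  ∈-fibre⁺ {g} ((g' , h') ∷ vs) (there p) with g' ≟ g
  ... | yes _ = there (∈-fibre⁺ vs p)
  ... | no _ = ∈-fibre⁺ vs p

  ∈-fibre⁻ : ∀ {g h} vs → h ∈ fibre g vs → (g , h) ∈ vs
  ∈-fibre⁻ {g} ((g' , h') ∷ vs) p with g' ≟ g | p
  ... | yes refl | here refl = here refl
  ... | yes _ | there q = there (∈-fibre⁻ vs q)
  ... | no _ | q = there (∈-fibre⁻ vs q)

  unique-fibres⇒unique : ∀ vs → (∀ g → Unique (fibre g vs)) → Unique vs
  unique-fibres⇒unique [] _ = []
  unique-fibres⇒unique ((g , h) ∷ vs) u =
    ¬Any⇒All¬ vs (λ p → Unique[x∷xs]⇒x∉xs (≡.subst Unique (fibre-here g h vs) (u g)) (∈-fibre⁺ vs p))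
      ∷ unique-fibres⇒unique vs tail
    where
    tail : ∀ g' → Unique (fibre g' vs)
    tail g' with g ≟ g' | u g'
    ... | yes _ | _ ∷ u' = u'
    ... | no _ | u' = u'

  enumerating-fibres⇒unique-complete : ∀ vs → (∀ g → IsEnumeration (fibre g vs)) → Unique vs × (∀ v → v ∈ vs)
  enumerating-fibres⇒unique-complete vs e =
    unique-fibres⇒unique vs (λ g → enumeration-unique (e g)) ,
    λ (g , h) → ∈-fibre⁻ vs (enumeration-complete (e g) h)

data Side : Set where
  lower upper : Side

opposite : Side → Side
opposite lower = upper
opposite upper = lower

module _ {m : ℕ} (H : FinGraph m) where

  JoinAdj : Side × Fin m → Side × Fin m → Set
  JoinAdj (lower , h) (lower , h') = Adj H h h'
  JoinAdj (upper , h) (upper , h') = Adj H h h'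
  JoinAdj _ _ = ⊤

  join : Graph (Side × Fin m)
  join = record { Adj = JoinAdj ; irrefl = λ {v} → irrefl′ {v} ; sym = λ {v} {w} → sym′ {v} {w} }
    where
    irrefl′ : ∀ {v} → ¬ JoinAdj v v
    irrefl′ {lower , _} = irrefl H
    irrefl′ {upper , _} = irrefl H
    sym′ : ∀ {v w} → JoinAdj v w → JoinAdj w v
    sym′ {lower , _} {lower , _} e = sym H e
    sym′ {lower , _} {upper , _} _ = tt
    sym′ {upper , _} {lower , _} _ = tt
    sym′ {upper , _} {upper , _} e = sym H e

  across : ∀ s {h h'} → JoinAdj (s , h) (opposite s , h')
  across lower = tt
  across upper = tt

  across⁻ : ∀ s {h h'} → JoinAdj (opposite s , h) (s , h')
  across⁻ lower = tt
  across⁻ upper = tt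

across-path : ∀ {m} (H : FinGraph m) s {h h'} → Path (join H) (s , h) (opposite s , h') ((s , h) ∷ (opposite s , h') ∷ [])
across-path H s = step (across H s) (stop _)

module _ {m : ℕ} where

  onSide : Side → Side × Fin m → Maybe (Fin m)
  onSide lower (lower , h) = just h
  onSide upper (upper , h) = just h
  onSide _ _ = nothing

  sideFibre : Side → List (Side × Fin m) → List (Fin m)
  sideFibre s = mapMaybe (onSide s)

  zigzag : Side → List (Fin m) → List (Fin m) → List (Side × Fin m)
  zigzag s [] _ = []
  zigzag s (_ ∷ _) [] = []
  zigzag s (x ∷ xs) (y ∷ ys) = (s , x) ∷ (opposite s , y) ∷ zigzag s xs ys

  sideFibre-zigzag : ∀ s xs ys → length xs ≡ length ys → sideFibre s (zigzag s xs ys) ≡ xs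
  sideFibre-zigzag s [] [] _ = refl
  sideFibre-zigzag lower (x ∷ xs) (y ∷ ys) eq = cong (x ∷_) (sideFibre-zigzag lower xs ys (suc-injective eq))
  sideFibre-zigzag upper (x ∷ xs) (y ∷ ys) eq = cong (x ∷_) (sideFibre-zigzag upper xs ys (suc-injective eq))

  sideFibre-zigzag-opposite : ∀ s xs ys → length xs ≡ length ys → sideFibre (opposite s) (zigzag s xs ys) ≡ ys
  sideFibre-zigzag-opposite s [] [] _ = refl
  sideFibre-zigzag-opposite lower (x ∷ xs) (y ∷ ys) eq = cong (y ∷_) (sideFibre-zigzag-opposite lower xs ys (suc-injective eq))
  sideFibre-zigzag-opposite upper (x ∷ xs) (y ∷ ys) eq = cong (y ∷_) (sideFibre-zigzag-opposite upper xs ys (suc-injective eq))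

  module _ (H : FinGraph m) where

    zigzag-path : ∀ s xs ys {h h' z rest} → Path (join H) (s , h') z rest →
                  Path (join H) (opposite s , h) z ((opposite s , h) ∷ zigzag s xs ys ++ rest)
    zigzag-path s [] _ p = step (across⁻ H s) p
    zigzag-path s (_ ∷ _) [] p = step (across⁻ H s) p
    zigzag-path s (x ∷ xs) (y ∷ ys) p = step (across⁻ H s) (step (across H s) (zigzag-path s xs ys p))

    zigzag-end : ∀ s xs ys h → ∃ λ h' → Path (join H) (opposite s , h) (opposite s , h') ((opposite s , h) ∷ zigzag s xs ys)
    zigzag-end s [] _ h = h , stop _
    zigzag-end s (_ ∷ _) [] h = h , stop _
    zigzag-end s (x ∷ xs) (y ∷ ys) h with zigzag-end s xs ys y
    ... | h' , p = h' , step (across⁻ H s) (step (across H s) p)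

  sideFibre-++ : ∀ s bs cs → sideFibre s (bs ++ cs) ≡ sideFibre s bs ++ sideFibre s cs
  sideFibre-++ s = mapMaybe-++ (onSide s)

sideFibre-∷ : ∀ {m} s s' (h : Fin m) bs →
              (s' ≡ s × sideFibre s ((s' , h) ∷ bs) ≡ h ∷ sideFibre s bs) ⊎
              (s' ≡ opposite s × sideFibre s ((s' , h) ∷ bs) ≡ sideFibre s bs)
sideFibre-∷ lower lower h bs = inj₁ (refl , refl)
sideFibre-∷ upper upper h bs = inj₁ (refl , refl)
sideFibre-∷ lower upper h bs = inj₂ (refl , refl)
sideFibre-∷ upper lower h bs = inj₂ (refl , refl)

module _ {m : ℕ} where

  fill : Side → List (Fin m) → List (Fin m) → List (Side × Fin m)
  fill s xs ys = zigzag s (complement xs) (complement ys)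

  module _ {xs ys : List (Fin m)} (ux : Unique xs) (uy : Unique ys) (|xs|≡|ys| : length xs ≡ length ys) where

    sideFibre-fill : ∀ s → sideFibre s (fill s xs ys) ≡ complement xs
    sideFibre-fill s = sideFibre-zigzag s (complement xs) (complement ys) (length-complement-cong ux uy |xs|≡|ys|)

    sideFibre-fill-opposite : ∀ s → sideFibre (opposite s) (fill s xs ys) ≡ complement ys
    sideFibre-fill-opposite s = sideFibre-zigzag-opposite s (complement xs) (complement ys) (length-complement-cong ux uy |xs|≡|ys|)

    sideFibre-fill-++ : ∀ s rest → sideFibre s (fill s xs ys ++ rest) ≡ complement xs ++ sideFibre s rest
    sideFibre-fill-++ s rest = trans (sideFibre-++ s (fill s xs ys) rest) (cong (_++ sideFibre s rest) (sideFibre-fill s))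

    sideFibre-fill-opposite-++ : ∀ s rest → sideFibre (opposite s) (fill s xs ys ++ rest) ≡ complement ys ++ sideFibre (opposite s) rest
    sideFibre-fill-opposite-++ s rest =
      trans (sideFibre-++ (opposite s) (fill s xs ys) rest) (cong (_++ sideFibre (opposite s) rest) (sideFibre-fill-opposite s))

fill-end : ∀ {m} (H : FinGraph m) s xs ys h →
           ∃ λ h' → Path (join H) (opposite s , h) (opposite s , h') ((opposite s , h) ∷ fill s xs ys)
fill-end H s xs ys = zigzag-end H s (complement xs) (complement ys)

fill-path : ∀ {m} (H : FinGraph m) s xs ys {h h' z rest} → Path (join H) (s , h') z rest →
            Path (join H) (opposite s , h) z ((opposite s , h) ∷ fill s xs ys ++ rest)
fill-path H s xs ys = zigzag-path H s (complement xs) (complement ys)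


double : ℕ → ℕ
double zero = zero
double (suc p) = suc (suc (double p))

double-mono-≤ : ∀ {p q} → p ≤ q → double p ≤ double q
double-mono-≤ z≤n = z≤n
double-mono-≤ (s≤s p≤q) = s≤s (s≤s (double-mono-≤ p≤q))

double-+ : ∀ p q → double (p + q) ≡ double p + double q
double-+ zero q = refl
double-+ (suc p) q = cong (λ i → suc (suc i)) (double-+ p q)

double≡2* : ∀ p → double p ≡ 2 * p
double≡2* zero = refl
double≡2* (suc p) = cong suc (trans (cong suc (double≡2* p)) (≡.sym (+-suc p (p + 0))))

layerIndex : ℕ → Side → ℕ
layerIndex p lower = double p
layerIndex p upper = suc (double p)

layerIndex-opposite : ∀ {p} s → layerIndex p (opposite s) ≢ layerIndex p s
layerIndex-opposite lower e = <⇒≢ (n<1+n _) (≡.sym e)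
layerIndex-opposite upper e = <⇒≢ (n<1+n _) e

before⇒≢layerIndex : ∀ {p i} → i < double p → ∀ s → i ≢ layerIndex p s
before⇒≢layerIndex i<2p lower refl = <-irrefl refl i<2p
before⇒≢layerIndex i<2p upper refl = <-irrefl refl (<-trans i<2p (n<1+n _))

after⇒≢layerIndex : ∀ {p i} → double (suc p) ≤ i → ∀ s → i ≢ layerIndex p s
after⇒≢layerIndex 2p+2≤i lower refl = <-irrefl refl (<-≤-trans (≤-trans (n≤1+n _) (n<1+n _)) 2p+2≤i)
after⇒≢layerIndex 2p+2≤i upper refl = <-irrefl refl 2p+2≤i

mirror : ℕ → ℕ → ℕ
mirror N i = N ∸ suc i

mirror-< : ∀ {N i} → i < N → mirror N i < N
mirror-< {suc N} {i} (s≤s _) = s≤s (m∸n≤m N i)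

mirror-involutive : ∀ {N i} → i < N → mirror N (mirror N i) ≡ i
mirror-involutive {suc N} (s≤s i≤N) = m∸[m∸n]≡n i≤N

mirror-suc : ∀ {N i} → suc i < N → mirror N i ≡ suc (mirror N (suc i))
mirror-suc {suc N} {i} (s≤s i<N) = +-∸-assoc 1 i<N

mirror-+-< : ∀ a {b i} → a ≤ i → i < a + b → mirror (a + b) i < b
mirror-+-< zero _ i<b = mirror-< i<b
mirror-+-< (suc a) (s≤s a≤i) (s≤s i<a+b) = mirror-+-< a a≤i i<a+b

mirror-+-≥ : ∀ a b {i} → i < a → b ≤ mirror (a + b) i
mirror-+-≥ (suc a) b {zero} _ = m≤n+m b a
mirror-+-≥ (suc a) b {suc i} (s≤s i<a) = mirror-+-≥ a b i<a

layerIndex-surjective : ∀ i → ∃ λ p → ∃ λ s → layerIndex p s ≡ i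
layerIndex-surjective zero = 0 , lower , refl
layerIndex-surjective (suc zero) = 0 , upper , refl
layerIndex-surjective (suc (suc i)) with layerIndex-surjective i
... | p , lower , refl = suc p , lower , refl
... | p , upper , refl = suc p , upper , refl

layerIndex<double⇒< : ∀ {p k} s → layerIndex p s < double k → p < k
layerIndex<double⇒< {zero} {suc k} _ _ = s≤s z≤n
layerIndex<double⇒< {suc p} {suc k} lower (s≤s (s≤s 2p+2<2k)) = s≤s (layerIndex<double⇒< lower 2p+2<2k)
layerIndex<double⇒< {suc p} {suc k} upper (s≤s (s≤s 2p+3<2k)) = s≤s (layerIndex<double⇒< upper 2p+3<2k)

data Position (p i : ℕ) : Set where
  before : i < double p → Position p i
  at     : ∀ s → i ≡ layerIndex p s → Position p i
  after  : double (suc p) ≤ i → Position p i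

position : ∀ p i → Position p i
position p i with <-cmp i (double p) | <-cmp i (suc (double p))
... | tri< i<2p _ _ | _ = before i<2p
... | tri≈ _ i≡2p _ | _ = at lower i≡2p
... | tri> _ _ _ | tri≈ _ i≡2p+1 _ = at upper i≡2p+1
... | tri> _ _ 2p<i | tri< i<2p+1 _ _ = contradiction i<2p+1 (≤⇒≯ 2p<i)
... | tri> _ _ _ | tri> _ _ 2p+1<i = after 2p+1<i

module _ {A B : Set} (f : A → B) where

  interleave-left : ∀ as X bs → map f as ++ X ++ map f bs ↭ X ++ map f (as ++ bs) ++ []
  interleave-left as X bs = begin
    map f as ++ X ++ map f bs      ↭⟨ shifts (map f as) X ⟩
    X ++ map f as ++ map f bs      ≡⟨ cong (X ++_) (≡.sym (trans (++-identityʳ _) (map-++ f as bs))) ⟩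
    X ++ map f (as ++ bs) ++ []    ∎
    where open PermutationReasoning

  interleave-right : ∀ as Y bs → map f as ++ Y ++ map f bs ↭ [] ++ map f (as ++ bs) ++ Y
  interleave-right as Y bs = begin
    map f as ++ Y ++ map f bs      ↭⟨ ++⁺ˡ (map f as) (++-comm Y (map f bs)) ⟩
    map f as ++ map f bs ++ Y      ≡⟨ ≡.sym (trans (cong (_++ Y) (map-++ f as bs)) (List.++-assoc (map f as) _ Y)) ⟩
    map f (as ++ bs) ++ Y          ∎
    where open PermutationReasoning

  interleave-both : ∀ as X bs Y cs → map f as ++ X ++ map f bs ++ Y ++ map f cs ↭ X ++ map f (as ++ bs ++ cs) ++ Y
  interleave-both as X bs Y cs = begin
    map f as ++ X ++ map f bs ++ Y ++ map f cs    ↭⟨ shifts (map f as) X ⟩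
    X ++ map f as ++ map f bs ++ Y ++ map f cs    ≡⟨ cong (X ++_) (≡.sym (trans (cong (_++ Y ++ map f cs) (map-++ f as bs))
                                                                              (List.++-assoc (map f as) _ _))) ⟩
    X ++ map f (as ++ bs) ++ Y ++ map f cs        ↭⟨ ++⁺ˡ X (interleave-right (as ++ bs) Y cs) ⟩
    X ++ map f ((as ++ bs) ++ cs) ++ Y            ≡⟨ cong (λ zs → X ++ map f zs ++ Y) (List.++-assoc as bs cs) ⟩
    X ++ map f (as ++ bs ++ cs) ++ Y              ∎
    where open PermutationReasoning

module LexProduct {n m : ℕ} (G : FinGraph n) (H : FinGraph m) where

  -- Layer i is the i-th vertex of a hamiltonian path of G; layers 2p and 2p+1 form block p.
  record Layering : Set where
    field
      blocks           : ℕ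
      layer            : ℕ → Fin n
      layer-adjacent   : ∀ i → suc i < double blocks → Adj G (layer i) (layer (suc i))
      layer-injective  : ∀ {i j} → i < double blocks → j < double blocks → layer i ≡ layer j → i ≡ j
      layer-surjective : ∀ g → ∃ λ i → i < double blocks × layer i ≡ g

  reverseLayering : Layering → Layering
  reverseLayering L = record
    { blocks = blocks
    ; layer = λ i → layer (mirror (double blocks) i)
    ; layer-adjacent = adjacent′
    ; layer-injective = λ i<2k j<2k e →
        trans (≡.sym (mirror-involutive i<2k))
              (trans (cong (mirror (double blocks)) (layer-injective (mirror-< i<2k) (mirror-< j<2k) e)) (mirror-involutive j<2k))
    ; layer-surjective = λ g → let (i , i<2k , e) = layer-surjective g in
        mirror (double blocks) i , mirror-< i<2k , trans (cong layer (mirror-involutive i<2k)) e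
    }
    where
    open Layering L
    adjacent′ : ∀ i → suc i < double blocks → Adj G (layer (mirror (double blocks) i)) (layer (mirror (double blocks) (suc i)))
    adjacent′ i i+1<2k rewrite mirror-suc i+1<2k =
      sym G (layer-adjacent _ (subst (_< double blocks) (mirror-suc i+1<2k) (mirror-< (<-trans (n<1+n i) i+1<2k))))

  module Layered (L : Layering) where
    open Layering L public

    record FillsLayers (s e : ℕ) (vs : List (Fin n × Fin m)) : Set where
      field
        inside : ∀ {i} → i < double blocks → s ≤ i → i < e → IsEnumeration (fibre (layer i) vs)
        below  : ∀ {i} → i < double blocks → i < s → fibre (layer i) vs ≡ []
        above  : ∀ {i} → i < double blocks → e ≤ i → fibre (layer i) vs ≡ []
    open FillsLayers

    Traversal : ℕ → ℕ → Fin n × Fin m → Fin n × Fin m → Set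
    Traversal s e u v = ∃ λ vs → Path (lex G H) u v vs × FillsLayers s e vs

    FillsLayers-[] : ∀ s → FillsLayers s s []
    FillsLayers-[] s = record
      { inside = λ _ s≤i i<s → contradiction i<s (≤⇒≯ s≤i) ; below = λ _ _ → refl ; above = λ _ _ → refl }

    FillsLayers-↭ : ∀ {s e us vs} → us ↭ vs → FillsLayers s e us → FillsLayers s e vs
    FillsLayers-↭ {us = us} {vs} us↭vs F = record
      { inside = λ i<2k s≤i i<e → ↭-trans (fibre-↭ _ (↭-sym us↭vs)) (inside F i<2k s≤i i<e)
      ; below = λ i<2k i<s → empty (below F i<2k i<s)
      ; above = λ i<2k e≤i → empty (above F i<2k e≤i) }
      where
      empty : ∀ {g} → fibre g us ≡ [] → fibre g vs ≡ []
      empty {g} eq = ↭-empty-inv (subst (fibre g vs ↭_) eq (fibre-↭ g (↭-sym us↭vs)))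

    FillsLayers-++ : ∀ {s e f us vs} → s ≤ e → e ≤ f → FillsLayers s e us → FillsLayers e f vs → FillsLayers s f (us ++ vs)
    FillsLayers-++ {s} {e} {f} {us} {vs} s≤e e≤f U V = record { inside = inside′ ; below = below′ ; above = above′ }
      where
      inside′ : ∀ {i} → i < double blocks → s ≤ i → i < f → IsEnumeration (fibre (layer i) (us ++ vs))
      inside′ {i} i<2k s≤i i<f rewrite fibre-++ (layer i) us vs with e ≤? i
      ... | yes e≤i rewrite above U i<2k e≤i = inside V i<2k e≤i i<f
      ... | no e≰i rewrite below V i<2k (≰⇒> e≰i) | ++-identityʳ (fibre (layer i) us) = inside U i<2k s≤i (≰⇒> e≰i)
      below′ : ∀ {i} → i < double blocks → i < s → fibre (layer i) (us ++ vs) ≡ []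
      below′ {i} i<2k i<s rewrite fibre-++ (layer i) us vs | below U i<2k i<s | below V i<2k (<-≤-trans i<s s≤e) = refl
      above′ : ∀ {i} → i < double blocks → f ≤ i → fibre (layer i) (us ++ vs) ≡ []
      above′ {i} i<2k f≤i rewrite fibre-++ (layer i) us vs | above U i<2k (≤-trans e≤f f≤i) | above V i<2k f≤i = refl

    Traversal-++ : ∀ {s e f u v v' w} → s ≤ e → e ≤ f →
                   Traversal s e u v → Adj (lex G H) v v' → Traversal e f v' w → Traversal s f u w
    Traversal-++ s≤e e≤f (us , path₁ , U) v~v' (vs , path₂ , V) = us ++ vs , path₁ ++⟨ v~v' ⟩ path₂ , FillsLayers-++ s≤e e≤f U V

    Traversal-reverse : ∀ {s e u v} → Traversal s e u v → Traversal s e v u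
    Traversal-reverse (vs , path , F) = reverse vs , Path-reverse path , FillsLayers-↭ (↭-sym (↭-reverse vs)) F

    Hamiltonian : Fin n × Fin m → Fin n × Fin m → Set
    Hamiltonian = Traversal 0 (double blocks)

    as-Hamiltonian : ∀ {k u v} → blocks ≡ k → Traversal 0 (double k) u v → Hamiltonian u v
    as-Hamiltonian refl T = T

    Hamiltonian⇒IsHamPath : ∀ {u v} → Hamiltonian u v → ∃ λ vs → IsHamPath (lex G H) vs × head vs ≡ just u × last vs ≡ just v
    Hamiltonian⇒IsHamPath (vs , path , F) =
      vs , (Path⇒Walk path , enumerating-fibres⇒unique-complete vs fibre-enumerates) , Path-head path , Path-last path
      where
      fibre-enumerates : ∀ g → IsEnumeration (fibre g vs)
      fibre-enumerates g with layer-surjective g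
      ... | i , i<2k , refl = FillsLayers.inside F i<2k z≤n i<2k

    embed : ℕ → Side × Fin m → Fin n × Fin m
    embed p (s , h) = layer (layerIndex p s) , h

    module _ {p : ℕ} (p<k : p < blocks) where

      private
        2p+1<2k : suc (double p) < double blocks
        2p+1<2k = double-mono-≤ p<k

        layerIndex<2k : ∀ s → layerIndex p s < double blocks
        layerIndex<2k lower = <-trans (n<1+n _) 2p+1<2k
        layerIndex<2k upper = 2p+1<2k

        lower~upper : Adj G (layer (double p)) (layer (suc (double p)))
        lower~upper = layer-adjacent (double p) 2p+1<2k

      embed-adjacent : ∀ {v w} → Adj (join H) v w → Adj (lex G H) (embed p v) (embed p w)
      embed-adjacent {lower , _} {lower , _} e = inj₂ (refl , e)
      embed-adjacent {lower , _} {upper , _} _ = inj₁ lower~upper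
      embed-adjacent {upper , _} {lower , _} _ = inj₁ (sym G lower~upper)
      embed-adjacent {upper , _} {upper , _} e = inj₂ (refl , e)

      embed-path : ∀ {v w bs} → Path (join H) v w bs → Path (lex G H) (embed p v) (embed p w) (map (embed p) bs)
      embed-path (stop v) = stop _
      embed-path (step {v} {w} e q) = step (embed-adjacent {v} {w} e) (embed-path q)

      fibre-embed : ∀ s bs → fibre (layer (layerIndex p s)) (map (embed p) bs) ≡ sideFibre s bs
      fibre-embed s [] = refl
      fibre-embed s ((s' , h) ∷ bs) with sideFibre-∷ s s' h bs
      ... | inj₁ (refl , eq) =
        trans (fibre-here (layer (layerIndex p s)) h (map (embed p) bs)) (trans (cong (h ∷_) (fibre-embed s bs)) (≡.sym eq))
      ... | inj₂ (refl , eq) = trans (fibre-elsewhere h (map (embed p) bs) distinct) (trans (fibre-embed s bs) (≡.sym eq))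
        where
        distinct : layer (layerIndex p (opposite s)) ≢ layer (layerIndex p s)
        distinct e = layerIndex-opposite s (layer-injective (layerIndex<2k (opposite s)) (layerIndex<2k s) e)

      fibre-embed-elsewhere : ∀ {i} → i < double blocks → (∀ s → i ≢ layerIndex p s) → ∀ bs → fibre (layer i) (map (embed p) bs) ≡ []
      fibre-embed-elsewhere i<2k i≢ [] = refl
      fibre-embed-elsewhere i<2k i≢ ((s , h) ∷ bs) =
        trans (fibre-elsewhere h (map (embed p) bs) (λ e → i≢ s (≡.sym (layer-injective (layerIndex<2k s) i<2k e))))
              (fibre-embed-elsewhere i<2k i≢ bs)

      block-fills : ∀ bs → IsEnumeration (sideFibre lower bs) → IsEnumeration (sideFibre upper bs) →
                    FillsLayers (double p) (double (suc p)) (map (embed p) bs)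
      block-fills bs lowerE upperE = record { inside = inside′ ; below = below′ ; above = above′ }
        where
        inside′ : ∀ {i} → i < double blocks → double p ≤ i → i < double (suc p) → IsEnumeration (fibre (layer i) (map (embed p) bs))
        inside′ {i} _ 2p≤i i<2p+2 with position p i
        ... | before i<2p = contradiction i<2p (≤⇒≯ 2p≤i)
        ... | at lower refl rewrite fibre-embed lower bs = lowerE
        ... | at upper refl rewrite fibre-embed upper bs = upperE
        ... | after 2p+2≤i = contradiction i<2p+2 (≤⇒≯ 2p+2≤i)
        below′ : ∀ {i} → i < double blocks → i < double p → fibre (layer i) (map (embed p) bs) ≡ []
        below′ i<2k i<2p = fibre-embed-elsewhere i<2k (before⇒≢layerIndex i<2p) bs
        above′ : ∀ {i} → i < double blocks → double (suc p) ≤ i → fibre (layer i) (map (embed p) bs) ≡ []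
        above′ i<2k 2p+2≤i = fibre-embed-elsewhere i<2k (after⇒≢layerIndex 2p+2≤i) bs

      around-block : ∀ {e left right vs} → double (suc p) ≤ e →
                     FillsLayers 0 (double p) left → FillsLayers (double (suc p)) e right →
                     ∀ bs → IsEnumeration (sideFibre lower bs) → IsEnumeration (sideFibre upper bs) →
                     vs ↭ left ++ map (embed p) bs ++ right → FillsLayers 0 e vs
      around-block 2p+2≤e Left Right bs lowerE upperE vs↭ =
        FillsLayers-↭ (↭-sym vs↭)
          (FillsLayers-++ z≤n (≤-trans 2p≤2p+2 2p+2≤e) Left
            (FillsLayers-++ 2p≤2p+2 2p+2≤e (block-fills bs lowerE upperE) Right))
        where
        2p≤2p+2 : double p ≤ double (suc p)
        2p≤2p+2 = double-mono-≤ (n≤1+n p)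

    upper→next-lower : ∀ {p} → suc p < blocks → ∀ {h h'} → Adj (lex G H) (layer (suc (double p)) , h) (layer (double (suc p)) , h')
    upper→next-lower p+1<k = inj₁ (layer-adjacent _ (≤-trans (n≤1+n _) (double-mono-≤ p+1<k)))

    next-lower→upper : ∀ {p} → suc p < blocks → ∀ {h h'} → Adj (lex G H) (layer (double (suc p)) , h') (layer (suc (double p)) , h)
    next-lower→upper p+1<k = sym (lex G H) (upper→next-lower p+1<k)

    locate : ∀ v → ∃ λ p → ∃ λ s → ∃ λ c → p < blocks × v ≡ embed p (s , c)
    locate (g , c) with layer-surjective g
    ... | i , i<2k , refl with layerIndex-surjective i
    ... | p , s , refl = p , s , c , layerIndex<double⇒< s i<2k , refl

    within-block : ∀ {p} → p < blocks → ∀ {x y bs} → Path (join H) x y bs →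
                   IsEnumeration (sideFibre lower bs) → IsEnumeration (sideFibre upper bs) →
                   Traversal (double p) (double (suc p)) (embed p x) (embed p y)
    within-block {p} p<k {bs = bs} path lowerE upperE = map (embed p) bs , embed-path p<k path , block-fills p<k bs lowerE upperE

    UpperLoop : ℕ → ℕ → ℕ → Set
    UpperLoop s e p = ∃ λ h → ∃ λ h' → Traversal s e (layer (suc (double p)) , h) (layer (suc (double p)) , h')

    LowerLoop : ℕ → ℕ → ℕ → Set
    LowerLoop s e p = ∃ λ h → ∃ λ h' → Traversal s e (layer (double p) , h) (layer (double p) , h')

    around-left : ∀ {t} → suc t < blocks → UpperLoop 0 (double (suc t)) t →
                  ∀ {x y z w bs₁ bs₂} → Path (join H) x (lower , y) bs₁ → Path (join H) (lower , z) w bs₂ →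
                  IsEnumeration (sideFibre lower (bs₁ ++ bs₂)) → IsEnumeration (sideFibre upper (bs₁ ++ bs₂)) →
                  Traversal 0 (double (suc (suc t))) (embed (suc t) x) (embed (suc t) w)
    around-left {t} t+1<k (_ , _ , E , Epath , EFills) {bs₁ = bs₁} {bs₂} path₁ path₂ lowerE upperE =
      map (embed (suc t)) bs₁ ++ E ++ map (embed (suc t)) bs₂ ,
      embed-path t+1<k path₁ ++⟨ next-lower→upper t+1<k ⟩ Epath ++⟨ upper→next-lower t+1<k ⟩ embed-path t+1<k path₂ ,
      around-block t+1<k ≤-refl EFills (FillsLayers-[] _) (bs₁ ++ bs₂) lowerE upperE (interleave-left (embed (suc t)) bs₁ E bs₂)

    around-right : 1 < blocks → LowerLoop 2 (double blocks) 1 →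
                   ∀ {x y z w bs₁ bs₂} → Path (join H) x (upper , y) bs₁ → Path (join H) (upper , z) w bs₂ →
                   IsEnumeration (sideFibre lower (bs₁ ++ bs₂)) → IsEnumeration (sideFibre upper (bs₁ ++ bs₂)) →
                   Traversal 0 (double blocks) (embed 0 x) (embed 0 w)
    around-right 1<k (_ , _ , D , Dpath , DFills) {bs₁ = bs₁} {bs₂} path₁ path₂ lowerE upperE =
      map (embed 0) bs₁ ++ D ++ map (embed 0) bs₂ ,
      embed-path 0<k path₁ ++⟨ upper→next-lower 1<k ⟩ Dpath ++⟨ next-lower→upper 1<k ⟩ embed-path 0<k path₂ ,
      around-block 0<k (double-mono-≤ (<⇒≤ 1<k)) (FillsLayers-[] 0) DFills (bs₁ ++ bs₂) lowerE upperE (interleave-right (embed 0) bs₁ D bs₂)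
      where
      0<k : 0 < blocks
      0<k = <-trans (n<1+n 0) 1<k

    around-both : ∀ {t} → suc (suc t) < blocks →
                  UpperLoop 0 (double (suc t)) t → LowerLoop (double (suc (suc t))) (double blocks) (suc (suc t)) →
                  ∀ {x y z y' z' w bs₁ bs₂ bs₃} → Path (join H) x (lower , y) bs₁ → Path (join H) (lower , z) (upper , y') bs₂ →
                  Path (join H) (upper , z') w bs₃ →
                  IsEnumeration (sideFibre lower (bs₁ ++ bs₂ ++ bs₃)) → IsEnumeration (sideFibre upper (bs₁ ++ bs₂ ++ bs₃)) →
                  Traversal 0 (double blocks) (embed (suc t) x) (embed (suc t) w)
    around-both {t} t+2<k (_ , _ , E , Epath , EFills) (_ , _ , D , Dpath , DFills) {bs₁ = bs₁} {bs₂ = bs₂} {bs₃ = bs₃}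
                path₁ path₂ path₃ lowerE upperE =
      map (embed (suc t)) bs₁ ++ E ++ map (embed (suc t)) bs₂ ++ D ++ map (embed (suc t)) bs₃ ,
      embed-path t+1<k path₁ ++⟨ next-lower→upper t+1<k ⟩ Epath ++⟨ upper→next-lower t+1<k ⟩
        embed-path t+1<k path₂ ++⟨ upper→next-lower t+2<k ⟩ Dpath ++⟨ next-lower→upper t+2<k ⟩ embed-path t+1<k path₃ ,
      around-block t+1<k (double-mono-≤ (<⇒≤ t+2<k)) EFills DFills (bs₁ ++ bs₂ ++ bs₃) lowerE upperE
        (interleave-both (embed (suc t)) bs₁ E bs₂ D bs₃)
      where
      t+1<k : suc t < blocks
      t+1<k = <-trans (n<1+n _) t+2<k

    record PairsWithin (p : ℕ) : Set where
      field
        lower-lower : ∀ {c d} → c ≢ d → Hamiltonian (embed p (lower , c)) (embed p (lower , d))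
        upper-upper : ∀ {c d} → c ≢ d → Hamiltonian (embed p (upper , c)) (embed p (upper , d))
        lower-upper : ∀ c d → Hamiltonian (embed p (lower , c)) (embed p (upper , d))

    same-block : ∀ {p} → PairsWithin p → ∀ s c s' d → embed p (s , c) ≢ embed p (s' , d) →
                 Hamiltonian (embed p (s , c)) (embed p (s' , d))
    same-block P lower c lower d u≢v = PairsWithin.lower-lower P (λ { refl → u≢v refl })
    same-block P upper c upper d u≢v = PairsWithin.upper-upper P (λ { refl → u≢v refl })
    same-block P lower c upper d _ = PairsWithin.lower-upper P c d
    same-block P upper c lower d _ = Traversal-reverse (PairsWithin.lower-upper P d c)

  module _ (L : Layering) where
    open Layered L
    private
      module R = Layered (reverseLayering L)

    reverse-layerIndex : ∀ {p q} → blocks ≡ p + suc q → ∀ s → R.layer (layerIndex q (opposite s)) ≡ layer (layerIndex p s)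
    reverse-layerIndex {p} {q} refl s = cong layer (mirror-layerIndex s)
      where
      2k≡ : double (p + suc q) ≡ double p + suc (suc (double q))
      2k≡ = double-+ p (suc q)
      mirror-layerIndex : ∀ s → mirror (double (p + suc q)) (layerIndex q (opposite s)) ≡ layerIndex p s
      mirror-layerIndex lower rewrite 2k≡ = m+n∸n≡m (double p) (suc (suc (double q)))
      mirror-layerIndex upper rewrite 2k≡ | +-suc (double p) (suc (double q)) = m+n∸n≡m (suc (double p)) (suc (double q))

    FillsLayers-unreverse : ∀ {j r vs} → blocks ≡ j + r → R.FillsLayers 0 (double r) vs →
                            FillsLayers (double j) (double blocks) vs
    FillsLayers-unreverse {j} {r} {vs} refl F = record
      { inside = λ {i} i<2k 2j≤i _ → subst (λ g → IsEnumeration (fibre g vs)) (back i<2k)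
                   (inside F (mirror-< i<2k) z≤n
                     (subst (λ N → mirror N i < double r) (≡.sym 2k≡) (mirror-+-< (double j) 2j≤i (subst (i <_) 2k≡ i<2k))))
      ; below = λ {i} i<2k i<2j → subst (λ g → fibre g vs ≡ []) (back i<2k)
                   (above F (mirror-< i<2k) (subst (λ N → double r ≤ mirror N i) (≡.sym 2k≡) (mirror-+-≥ (double j) (double r) i<2j)))
      ; above = λ i<2k 2k≤i → contradiction i<2k (≤⇒≯ 2k≤i)
      }
      where
      open R.FillsLayers
      2k≡ : double (j + r) ≡ double j + double r
      2k≡ = double-+ j r
      back : ∀ {i} → i < double (j + r) → R.layer (mirror (double (j + r)) i) ≡ layer i
      back i<2k = cong layer (mirror-involutive i<2k)

    Hamiltonian-unreverse : ∀ {p q} → blocks ≡ p + suc q → ∀ {s s' c d} →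
                            R.Hamiltonian (R.embed q (opposite s , c)) (R.embed q (opposite s' , d)) →
                            Hamiltonian (embed p (s , c)) (embed p (s' , d))
    Hamiltonian-unreverse eq {s} {s'} {c} {d} (vs , path , F) =
      vs , subst₂ (λ x y → Path (lex G H) (x , c) (y , d) vs) (reverse-layerIndex eq s) (reverse-layerIndex eq s') path ,
      FillsLayers-unreverse refl F

    mirror-block : ∀ {p} → p < blocks → ∃ λ q → blocks ≡ p + suc q
    mirror-block {p} p<k = let (q , eq) = m≤n⇒∃[o]m+o≡n p<k in q , trans (≡.sym eq) (≡.sym (+-suc p q))


module OneSided {n m : ℕ} {G : FinGraph n} {H : FinGraph m} (L : LexProduct.Layering G H)
                {a b : Fin m} (ab : Adj H a b) where
  open LexProduct G H
  open Layered L

  a≢b : a ≢ b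
  a≢b refl = irrefl H ab

  unique-ab : Unique (a ∷ b ∷ [])
  unique-ab = unique₂ a≢b

  private
    ab-rest = fill lower (a ∷ b ∷ []) (a ∷ b ∷ [])

    ab-rest-enumerates : ∀ s → IsEnumeration (a ∷ b ∷ sideFibre s ab-rest)
    ab-rest-enumerates lower rewrite sideFibre-fill unique-ab unique-ab refl lower = ++-complement-enumeration unique-ab
    ab-rest-enumerates upper rewrite sideFibre-fill-opposite unique-ab unique-ab refl lower = ++-complement-enumeration unique-ab

    b-up-and-fill : ∃ λ h → Path (join H) (lower , b) (upper , h) ((lower , b) ∷ (upper , b) ∷ ab-rest)
    b-up-and-fill = let (h , path) = fill-end H lower (a ∷ b ∷ []) (a ∷ b ∷ []) b in h , step tt path

  -- In block 0 the edge ab lets the loop end in the layer it started from;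
  -- in later blocks the inner loop plays that role.
  excursion : ∀ t → t < blocks → UpperLoop 0 (double (suc t)) t
  excursion zero 0<k = a , h , within-block 0<k path (ab-rest-enumerates lower) (ab-rest-enumerates upper)
    where
    h = proj₁ b-up-and-fill
    path : Path (join H) (upper , a) (upper , h) ((upper , a) ∷ (lower , a) ∷ (lower , b) ∷ (upper , b) ∷ ab-rest)
    path = step tt (step ab (proj₂ b-up-and-fill))
  excursion (suc t) t+1<k =
    let (h , path) = b-up-and-fill in
    a , h , around-left t+1<k (excursion t (<-trans (n<1+n t) t+1<k)) (across-path H upper) path
                        (ab-rest-enumerates lower) (ab-rest-enumerates upper)

  other : Fin m → Fin m
  other c with c ≟ a
  ... | yes _ = b
  ... | no _ = a

  other-≢ : ∀ c → c ≢ other c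
  other-≢ c with c ≟ a
  ... | yes refl = a≢b
  ... | no c≢a = c≢a

  unique-other : ∀ c → Unique (c ∷ other c ∷ [])
  unique-other c = unique₂ (other-≢ c)

  Sweep : ℕ → Fin n × Fin m → Set
  Sweep p u = ∃ λ h → Traversal 0 (double (suc p)) u (layer (suc (double p)) , h)

  private
    straight : Fin m → List (Side × Fin m)
    straight c = (lower , c) ∷ (upper , c) ∷ fill lower (c ∷ []) (c ∷ [])

    straight-path : ∀ c → ∃ λ h → Path (join H) (lower , c) (upper , h) (straight c)
    straight-path c = let (h , path) = fill-end H lower (c ∷ []) (c ∷ []) c in h , step tt path

    straight-enumerates : ∀ c s → IsEnumeration (sideFibre s (straight c))
    straight-enumerates c lower rewrite sideFibre-fill (unique₁ c) (unique₁ c) refl lower = ++-complement-enumeration (unique₁ c)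
    straight-enumerates c upper rewrite sideFibre-fill-opposite (unique₁ c) (unique₁ c) refl lower = ++-complement-enumeration (unique₁ c)

    straight-through : ∀ {p} → p < blocks → ∀ c →
                       ∃ λ h → Traversal (double p) (double (suc p)) (layer (double p) , c) (layer (suc (double p)) , h)
    straight-through p<k c =
      let (h , path) = straight-path c in h , within-block p<k path (straight-enumerates c lower) (straight-enumerates c upper)

  sweep-extend : ∀ {j u} → suc j < blocks → Sweep j u → Sweep (suc j) u
  sweep-extend {j} j+1<k (_ , T) =
    let (h , T′) = straight-through j+1<k a in h , Traversal-++ z≤n (double-mono-≤ (n≤1+n _)) T (upper→next-lower j+1<k) T′

  sweep-extend* : ∀ {j u} r → j + r < blocks → Sweep j u → Sweep (j + r) u
  sweep-extend* {j} zero j<k S rewrite +-identityʳ j = S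
  sweep-extend* {j} (suc r) j+r+1<k S rewrite +-suc j r = sweep-extend j+r+1<k (sweep-extend* r (<-trans (n<1+n _) j+r+1<k) S)

  sweep : ∀ p → p < blocks → ∀ s c → Sweep p (embed p (s , c))
  sweep zero 0<k lower c = straight-through 0<k c
  sweep zero 0<k upper c =
    h , within-block 0<k path enum-lower enum-upper
    where
    c' = other c
    ucc' = unique-other c
    h = proj₁ (fill-end H lower (a ∷ b ∷ []) (c ∷ c' ∷ []) c')
    path : Path (join H) (upper , c) (upper , h)
                ((upper , c) ∷ (lower , a) ∷ (lower , b) ∷ (upper , c') ∷ fill lower (a ∷ b ∷ []) (c ∷ c' ∷ []))
    path = step tt (step ab (step tt (proj₂ (fill-end H lower (a ∷ b ∷ []) (c ∷ c' ∷ []) c'))))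
    enum-lower : IsEnumeration (a ∷ b ∷ sideFibre lower (fill lower (a ∷ b ∷ []) (c ∷ c' ∷ [])))
    enum-lower rewrite sideFibre-fill unique-ab ucc' refl lower = ++-complement-enumeration unique-ab
    enum-upper : IsEnumeration (c ∷ c' ∷ sideFibre upper (fill lower (a ∷ b ∷ []) (c ∷ c' ∷ [])))
    enum-upper rewrite sideFibre-fill-opposite unique-ab ucc' refl lower = ++-complement-enumeration ucc'
  sweep (suc t) t+1<k lower c =
    h , around-left t+1<k (excursion t (<-trans (n<1+n t) t+1<k)) (stop (lower , c)) path enum-lower enum-upper
    where
    c' = other c
    ucc' = unique-other c
    h = proj₁ (fill-end H lower (c ∷ c' ∷ []) (a ∷ b ∷ []) b)
    path : Path (join H) (lower , c') (upper , h) ((lower , c') ∷ (upper , a) ∷ (upper , b) ∷ fill lower (c ∷ c' ∷ []) (a ∷ b ∷ []))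
    path = step tt (step ab (proj₂ (fill-end H lower (c ∷ c' ∷ []) (a ∷ b ∷ []) b)))
    enum-lower : IsEnumeration (c ∷ c' ∷ sideFibre lower (fill lower (c ∷ c' ∷ []) (a ∷ b ∷ [])))
    enum-lower rewrite sideFibre-fill ucc' unique-ab refl lower = ++-complement-enumeration ucc'
    enum-upper : IsEnumeration (a ∷ b ∷ sideFibre upper (fill lower (c ∷ c' ∷ []) (a ∷ b ∷ [])))
    enum-upper rewrite sideFibre-fill-opposite ucc' unique-ab refl lower = ++-complement-enumeration unique-ab
  sweep (suc t) t+1<k upper c =
    h , around-left t+1<k (excursion t (<-trans (n<1+n t) t+1<k)) (across-path H upper) path (enum lower) (enum upper)
    where
    c' = other c
    ucc' = unique-other c
    h = proj₁ (fill-end H lower (c ∷ c' ∷ []) (c ∷ c' ∷ []) c')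
    path : Path (join H) (lower , c') (upper , h) ((lower , c') ∷ (upper , c') ∷ fill lower (c ∷ c' ∷ []) (c ∷ c' ∷ []))
    path = step tt (proj₂ (fill-end H lower (c ∷ c' ∷ []) (c ∷ c' ∷ []) c'))
    enum : ∀ s → IsEnumeration (c ∷ c' ∷ sideFibre s (fill lower (c ∷ c' ∷ []) (c ∷ c' ∷ [])))
    enum lower rewrite sideFibre-fill ucc' ucc' refl lower = ++-complement-enumeration ucc'
    enum upper rewrite sideFibre-fill-opposite ucc' ucc' refl lower = ++-complement-enumeration ucc'

  lone-mixed : blocks ≡ 1 → ∀ c d → Hamiltonian (embed 0 (lower , c)) (embed 0 (upper , d))
  lone-mixed k≡1 c d = as-Hamiltonian k≡1 (within-block (subst (0 <_) (≡.sym k≡1) (s≤s z≤n)) path enum-lower enum-upper)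
    where
    rest = (upper , d) ∷ []
    path : Path (join H) (lower , c) (upper , d) ((lower , c) ∷ fill upper (d ∷ []) (c ∷ []) ++ rest)
    path = fill-path H upper (d ∷ []) (c ∷ []) (stop (upper , d))
    enum-lower : IsEnumeration (c ∷ sideFibre lower (fill upper (d ∷ []) (c ∷ []) ++ rest))
    enum-lower rewrite sideFibre-fill-opposite-++ (unique₁ d) (unique₁ c) refl upper rest = complement-enumeration (c ∷ []) [] (unique₁ c)
    enum-upper : IsEnumeration (sideFibre upper (fill upper (d ∷ []) (c ∷ []) ++ rest))
    enum-upper rewrite sideFibre-fill-++ (unique₁ d) (unique₁ c) refl upper rest = complement-enumeration [] (d ∷ []) (unique₁ d)

  lone-lower : blocks ≡ 1 → ∀ {c d} → c ≢ d → Hamiltonian (embed 0 (lower , c)) (embed 0 (lower , d))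
  lone-lower k≡1 {c} {d} c≢d = as-Hamiltonian k≡1 (within-block (subst (0 <_) (≡.sym k≡1) (s≤s z≤n)) path enum-lower enum-upper)
    where
    ucd = unique₂ c≢d
    rest = (lower , d) ∷ []
    path : Path (join H) (lower , c) (lower , d) ((lower , c) ∷ (upper , a) ∷ (upper , b) ∷ fill lower (c ∷ d ∷ []) (a ∷ b ∷ []) ++ rest)
    path = step tt (step ab (fill-path H lower (c ∷ d ∷ []) (a ∷ b ∷ []) (stop (lower , d))))
    enum-lower : IsEnumeration (c ∷ sideFibre lower (fill lower (c ∷ d ∷ []) (a ∷ b ∷ []) ++ rest))
    enum-lower rewrite sideFibre-fill-++ ucd unique-ab refl lower rest = complement-enumeration (c ∷ []) (d ∷ []) ucd
    enum-upper : IsEnumeration (a ∷ b ∷ sideFibre upper (fill lower (c ∷ d ∷ []) (a ∷ b ∷ []) ++ rest))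
    enum-upper rewrite sideFibre-fill-opposite-++ ucd unique-ab refl lower rest = complement-enumeration (a ∷ b ∷ []) [] unique-ab

  module _ {t : ℕ} (k≡ : blocks ≡ suc (suc t)) where

    private
      t+1<k : suc t < blocks
      t+1<k = subst (suc t <_) (≡.sym k≡) ≤-refl

      E : UpperLoop 0 (double (suc t)) t
      E = excursion t (<-trans (n<1+n t) t+1<k)

    last-mixed-to-b : ∀ c → Hamiltonian (embed (suc t) (lower , c)) (embed (suc t) (upper , b))
    last-mixed-to-b c = as-Hamiltonian k≡ (around-left t+1<k E (stop (lower , c)) path enum-lower enum-upper)
      where
      c' = other c
      ucc' = unique-other c
      rest = (upper , a) ∷ (upper , b) ∷ []
      path : Path (join H) (lower , c') (upper , b) ((lower , c') ∷ fill upper (a ∷ b ∷ []) (c ∷ c' ∷ []) ++ rest)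
      path = fill-path H upper (a ∷ b ∷ []) (c ∷ c' ∷ []) (step ab (stop (upper , b)))
      enum-lower : IsEnumeration (c ∷ c' ∷ sideFibre lower (fill upper (a ∷ b ∷ []) (c ∷ c' ∷ []) ++ rest))
      enum-lower rewrite sideFibre-fill-opposite-++ unique-ab ucc' refl upper rest = complement-enumeration (c ∷ c' ∷ []) [] ucc'
      enum-upper : IsEnumeration (sideFibre upper (fill upper (a ∷ b ∷ []) (c ∷ c' ∷ []) ++ rest))
      enum-upper rewrite sideFibre-fill-++ unique-ab ucc' refl upper rest = complement-enumeration [] (a ∷ b ∷ []) unique-ab

    last-mixed-avoiding : CanInsert 2 → ∀ c {d} → d ≢ a → d ≢ b → Hamiltonian (embed (suc t) (lower , c)) (embed (suc t) (upper , d))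
    last-mixed-avoiding insert₂ c {d} d≢a d≢b = as-Hamiltonian k≡ (around-left t+1<k E path₁ path₂ enum-lower enum-upper)
      where
      x₁ = other c
      x₂ = proj₁ (insert₂ (c ∷ x₁ ∷ []) (unique-other c) refl)
      ucx = proj₂ (insert₂ (c ∷ x₁ ∷ []) (unique-other c) refl)
      uabd = unique₃ a≢b (≢-sym d≢a) (≢-sym d≢b)
      rest = (upper , d) ∷ []
      path₁ : Path (join H) (lower , c) (lower , x₁) ((lower , c) ∷ (upper , a) ∷ (upper , b) ∷ (lower , x₁) ∷ [])
      path₁ = step tt (step ab (step tt (stop _)))
      path₂ : Path (join H) (lower , x₂) (upper , d) ((lower , x₂) ∷ fill upper (a ∷ b ∷ d ∷ []) (c ∷ x₁ ∷ x₂ ∷ []) ++ rest)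
      path₂ = fill-path H upper (a ∷ b ∷ d ∷ []) (c ∷ x₁ ∷ x₂ ∷ []) (stop (upper , d))
      enum-lower : IsEnumeration (c ∷ x₁ ∷ x₂ ∷ sideFibre lower (fill upper (a ∷ b ∷ d ∷ []) (c ∷ x₁ ∷ x₂ ∷ []) ++ rest))
      enum-lower rewrite sideFibre-fill-opposite-++ uabd ucx refl upper rest = complement-enumeration (c ∷ x₁ ∷ x₂ ∷ []) [] ucx
      enum-upper : IsEnumeration (a ∷ b ∷ sideFibre upper (fill upper (a ∷ b ∷ d ∷ []) (c ∷ x₁ ∷ x₂ ∷ []) ++ rest))
      enum-upper rewrite sideFibre-fill-++ uabd ucx refl upper rest = complement-enumeration (a ∷ b ∷ []) (d ∷ []) uabd

    last-lower-adjacent : CanInsert 2 → ∀ {g} → Adj H b g → a ≢ g → ∀ {c d} → c ≢ d →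
                          Hamiltonian (embed (suc t) (lower , c)) (embed (suc t) (lower , d))
    last-lower-adjacent insert₂ {g} bg a≢g {c} {d} c≢d = as-Hamiltonian k≡ (around-left t+1<k E (stop (lower , c)) path enum-lower enum-upper)
      where
      x₁ = proj₁ (insert₂ (c ∷ []) (unique₂ c≢d) refl)
      ucxd = proj₂ (insert₂ (c ∷ []) (unique₂ c≢d) refl)
      uabg = unique₃ a≢b a≢g (λ { refl → irrefl H bg })
      rest = (lower , d) ∷ []
      path : Path (join H) (lower , x₁) (lower , d)
                  ((lower , x₁) ∷ (upper , a) ∷ (upper , b) ∷ (upper , g) ∷ fill lower (c ∷ x₁ ∷ d ∷ []) (a ∷ b ∷ g ∷ []) ++ rest)
      path = step tt (step ab (step bg (fill-path H lower (c ∷ x₁ ∷ d ∷ []) (a ∷ b ∷ g ∷ []) (stop (lower , d)))))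
      enum-lower : IsEnumeration (c ∷ x₁ ∷ sideFibre lower (fill lower (c ∷ x₁ ∷ d ∷ []) (a ∷ b ∷ g ∷ []) ++ rest))
      enum-lower rewrite sideFibre-fill-++ ucxd uabg refl lower rest = complement-enumeration (c ∷ x₁ ∷ []) (d ∷ []) ucxd
      enum-upper : IsEnumeration (a ∷ b ∷ g ∷ sideFibre upper (fill lower (c ∷ x₁ ∷ d ∷ []) (a ∷ b ∷ g ∷ []) ++ rest))
      enum-upper rewrite sideFibre-fill-opposite-++ ucxd uabg refl lower rest = complement-enumeration (a ∷ b ∷ g ∷ []) [] uabg

    last-lower-disjoint : CanInsert 2 → CanInsert 3 → ∀ {e g} → Adj H e g → a ≢ e → a ≢ g → b ≢ e → b ≢ g → ∀ {c d} → c ≢ d →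
                          Hamiltonian (embed (suc t) (lower , c)) (embed (suc t) (lower , d))
    last-lower-disjoint insert₂ insert₃ {e} {g} eg a≢e a≢g b≢e b≢g {c} {d} c≢d =
      as-Hamiltonian k≡ (around-left t+1<k E (stop (lower , c)) path enum-lower enum-upper)
      where
      x₁ = proj₁ (insert₂ (c ∷ []) (unique₂ c≢d) refl)
      ucxd = proj₂ (insert₂ (c ∷ []) (unique₂ c≢d) refl)
      x₂ = proj₁ (insert₃ (c ∷ x₁ ∷ []) ucxd refl)
      ucxxd = proj₂ (insert₃ (c ∷ x₁ ∷ []) ucxd refl)
      uabeg = unique₄ a≢b a≢e a≢g b≢e b≢g (λ { refl → irrefl H eg })
      rest = (lower , d) ∷ []
      path : Path (join H) (lower , x₁) (lower , d)
                  ((lower , x₁) ∷ (upper , a) ∷ (upper , b) ∷ (lower , x₂) ∷ (upper , e) ∷ (upper , g) ∷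
                   fill lower (c ∷ x₁ ∷ x₂ ∷ d ∷ []) (a ∷ b ∷ e ∷ g ∷ []) ++ rest)
      path = step tt (step ab (step tt (step tt (step eg
               (fill-path H lower (c ∷ x₁ ∷ x₂ ∷ d ∷ []) (a ∷ b ∷ e ∷ g ∷ []) (stop (lower , d)))))))
      enum-lower : IsEnumeration (c ∷ x₁ ∷ x₂ ∷ sideFibre lower (fill lower (c ∷ x₁ ∷ x₂ ∷ d ∷ []) (a ∷ b ∷ e ∷ g ∷ []) ++ rest))
      enum-lower rewrite sideFibre-fill-++ ucxxd uabeg refl lower rest = complement-enumeration (c ∷ x₁ ∷ x₂ ∷ []) (d ∷ []) ucxxd
      enum-upper : IsEnumeration (a ∷ b ∷ e ∷ g ∷ sideFibre upper (fill lower (c ∷ x₁ ∷ x₂ ∷ d ∷ []) (a ∷ b ∷ e ∷ g ∷ []) ++ rest))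
      enum-upper rewrite sideFibre-fill-opposite-++ ucxxd uabeg refl lower rest = complement-enumeration (a ∷ b ∷ e ∷ g ∷ []) [] uabeg

module TwoSided {n m : ℕ} {G : FinGraph n} {H : FinGraph m} (L : LexProduct.Layering G H)
                {a b : Fin m} (ab : Adj H a b) where
  open LexProduct G H
  open Layered L
  open OneSided L ab
  private
    module R where
      open Layered (reverseLayering L) public
      open OneSided (reverseLayering L) ab public

  unreverse : ∀ {j r u v} → blocks ≡ j + r → R.Traversal 0 (double r) u v → Traversal (double j) (double blocks) u v
  unreverse eq (vs , path , F) = vs , path , FillsLayers-unreverse L eq F

  right-excursion : ∀ p t → blocks ≡ suc p + suc t → LowerLoop (double (suc p)) (double blocks) (suc p)
  right-excursion p t eq =
    let (h , h' , T) = R.excursion t t<k in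
    h , h' , subst (λ g → Traversal _ _ (g , h) (g , h')) (reverse-layerIndex L eq lower) (unreverse eq T)
    where
    t<k : t < blocks
    t<k = subst (t <_) (≡.sym eq) (m≤n+m (suc t) (suc p))

  sweep-right : ∀ q r → blocks ≡ q + suc r → ∀ s c →
                ∃ λ h → Traversal (double q) (double blocks) (layer (double q) , h) (embed q (s , c))
  sweep-right q r eq s c =
    h , subst₂ (λ g g' → Traversal _ _ (g , h) (g' , c)) (reverse-layerIndex L eq lower) (reverse-layerIndex L eq s)
          (unreverse eq (R.Traversal-reverse T))
    where
    r<k : r < blocks
    r<k = subst (r <_) (≡.sym eq) (m≤n+m (suc r) q)
    h = proj₁ (R.sweep r r<k (opposite s) c)
    T = proj₂ (R.sweep r r<k (opposite s) c)

  apart : ∀ {p q} → p < q → q < blocks → ∀ s₁ c₁ s₂ c₂ → Hamiltonian (embed p (s₁ , c₁)) (embed q (s₂ , c₂))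
  apart {p} p<q q<k s₁ c₁ s₂ c₂ with m≤n⇒∃[o]m+o≡n p<q | m≤n⇒∃[o]m+o≡n q<k
  ... | r , refl | r' , k≡ =
    Traversal-++ z≤n (double-mono-≤ (<⇒≤ q<k))
      (proj₂ (sweep-extend* r p+r<k (sweep p (≤-<-trans (m≤m+n p r) p+r<k) s₁ c₁)))
      (upper→next-lower q<k)
      (proj₂ (sweep-right (suc (p + r)) r' (≡.sym (trans (+-suc (suc (p + r)) r') k≡)) s₂ c₂))
    where
    p+r<k : p + r < blocks
    p+r<k = <-trans (n<1+n _) q<k

  first-lower : ∀ t → blocks ≡ suc (suc t) → ∀ {c d} → c ≢ d → Hamiltonian (embed 0 (lower , c)) (embed 0 (lower , d))
  first-lower t k≡ {c} {d} c≢d = around-right 1<k (right-excursion 0 t k≡) (across-path H lower) path enum-lower enum-upper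
    where
    1<k : 1 < blocks
    1<k = subst (1 <_) (≡.sym k≡) (s≤s (s≤s z≤n))
    ucd = unique₂ c≢d
    rest = (lower , d) ∷ []
    path : Path (join H) (upper , d) (lower , d) ((upper , d) ∷ fill lower (c ∷ d ∷ []) (c ∷ d ∷ []) ++ rest)
    path = fill-path H lower (c ∷ d ∷ []) (c ∷ d ∷ []) (stop (lower , d))
    enum-lower : IsEnumeration (c ∷ sideFibre lower (fill lower (c ∷ d ∷ []) (c ∷ d ∷ []) ++ rest))
    enum-lower rewrite sideFibre-fill-++ ucd ucd refl lower rest = complement-enumeration (c ∷ []) (d ∷ []) ucd
    enum-upper : IsEnumeration (c ∷ d ∷ sideFibre upper (fill lower (c ∷ d ∷ []) (c ∷ d ∷ []) ++ rest))
    enum-upper rewrite sideFibre-fill-opposite-++ ucd ucd refl lower rest = complement-enumeration (c ∷ d ∷ []) [] ucd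

  module _ {p t : ℕ} (k≡ : blocks ≡ suc (suc p) + suc t) where

    private
      p+2<k : suc (suc p) < blocks
      p+2<k = subst (suc (suc p) <_) (≡.sym k≡) (m<m+n (suc (suc p)) (s≤s z≤n))

      E : UpperLoop 0 (double (suc p)) p
      E = excursion p (<-trans (n<1+n p) (<-trans (n<1+n _) p+2<k))

      D : LowerLoop (double (suc (suc p))) (double blocks) (suc (suc p))
      D = right-excursion (suc p) t k≡

    middle-mixed : ∀ c d → Hamiltonian (embed (suc p) (lower , c)) (embed (suc p) (upper , d))
    middle-mixed c d = around-both p+2<k E D (stop (lower , c)) path (stop (upper , d)) enum-lower enum-upper
      where
      x₁ = other c
      y₁ = other d
      ucx = unique-other c
      uyd = unique₂ (≢-sym (other-≢ d))
      fl = fill upper (y₁ ∷ d ∷ []) (c ∷ x₁ ∷ [])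
      path : Path (join H) (lower , x₁) (upper , y₁) ((lower , x₁) ∷ fl ++ (upper , y₁) ∷ [])
      path = fill-path H upper (y₁ ∷ d ∷ []) (c ∷ x₁ ∷ []) (stop (upper , y₁))
      enum-lower : IsEnumeration (c ∷ x₁ ∷ sideFibre lower ((fl ++ (upper , y₁) ∷ []) ++ (upper , d) ∷ []))
      enum-lower rewrite List.++-assoc fl ((upper , y₁) ∷ []) ((upper , d) ∷ [])
                       | sideFibre-fill-opposite-++ uyd ucx refl upper ((upper , y₁) ∷ (upper , d) ∷ []) =
        complement-enumeration (c ∷ x₁ ∷ []) [] ucx
      enum-upper : IsEnumeration (sideFibre upper ((fl ++ (upper , y₁) ∷ []) ++ (upper , d) ∷ []))
      enum-upper rewrite List.++-assoc fl ((upper , y₁) ∷ []) ((upper , d) ∷ [])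
                       | sideFibre-fill-++ uyd ucx refl upper ((upper , y₁) ∷ (upper , d) ∷ []) =
        complement-enumeration [] (y₁ ∷ d ∷ []) uyd

    middle-lower : CanInsert 2 → ∀ {c d} → c ≢ d → Hamiltonian (embed (suc p) (lower , c)) (embed (suc p) (lower , d))
    middle-lower insert₂ {c} {d} c≢d = around-both p+2<k E D (stop (lower , c)) path₂ path₃ enum-lower enum-upper
      where
      x₁ = proj₁ (insert₂ (c ∷ []) (unique₂ c≢d) refl)
      ucxd = proj₂ (insert₂ (c ∷ []) (unique₂ c≢d) refl)
      y₁ = proj₁ (insert₂ (a ∷ b ∷ []) unique-ab refl)
      uaby = proj₂ (insert₂ (a ∷ b ∷ []) unique-ab refl)
      rest = (lower , d) ∷ []
      path₂ : Path (join H) (lower , x₁) (upper , b) ((lower , x₁) ∷ (upper , a) ∷ (upper , b) ∷ [])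
      path₂ = step tt (step ab (stop _))
      path₃ : Path (join H) (upper , y₁) (lower , d) ((upper , y₁) ∷ fill lower (c ∷ x₁ ∷ d ∷ []) (a ∷ b ∷ y₁ ∷ []) ++ rest)
      path₃ = fill-path H lower (c ∷ x₁ ∷ d ∷ []) (a ∷ b ∷ y₁ ∷ []) (stop (lower , d))
      enum-lower : IsEnumeration (c ∷ x₁ ∷ sideFibre lower (fill lower (c ∷ x₁ ∷ d ∷ []) (a ∷ b ∷ y₁ ∷ []) ++ rest))
      enum-lower rewrite sideFibre-fill-++ ucxd uaby refl lower rest = complement-enumeration (c ∷ x₁ ∷ []) (d ∷ []) ucxd
      enum-upper : IsEnumeration (a ∷ b ∷ y₁ ∷ sideFibre upper (fill lower (c ∷ x₁ ∷ d ∷ []) (a ∷ b ∷ y₁ ∷ []) ++ rest))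
      enum-upper rewrite sideFibre-fill-opposite-++ ucxd uaby refl lower rest = complement-enumeration (a ∷ b ∷ y₁ ∷ []) [] uaby

  connected : (∀ {p} → p < blocks → PairsWithin p) → ∀ u v → u ≢ v → Hamiltonian u v
  connected pairs u v u≢v with locate u | locate v
  ... | p , s , c , p<k , refl | q , s' , d , q<k , refl with <-cmp p q
  ... | tri< p<q _ _ = apart p<q q<k s c s' d
  ... | tri> _ _ q<p = Traversal-reverse (apart q<p p<k s' d s c)
  ... | tri≈ _ refl _ = same-block (pairs p<k) s c s' d u≢v


SameEdge : ∀ {m} → Fin m → Fin m → Fin m → Fin m → Set
SameEdge a b e f = (a ≡ e × b ≡ f) ⊎ (a ≡ f × b ≡ e)

module SameBlock {n m : ℕ} {G : FinGraph n} {H : FinGraph m} (L : LexProduct.Layering G H)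
                 {a b : Fin m} (ab : Adj H a b) {e f : Fin m} (ef : Adj H e f) (distinct : ¬ SameEdge a b e f) where
  open LexProduct G H
  open Layered L
  open TwoSided L ab
  open OneSided L ab
  private
    module BA = OneSided L (sym H ab)

  e≢f : e ≢ f
  e≢f refl = irrefl H ef

  third : ∃ λ w → a ≢ w × b ≢ w
  third with e ≟ a | e ≟ b
  ... | yes refl | _ = f , e≢f , (λ b≡f → distinct (inj₁ (refl , b≡f)))
  ... | no e≢a | yes refl = f , (λ a≡f → distinct (inj₂ (a≡f , refl))) , e≢f
  ... | no e≢a | no e≢b = e , ≢-sym e≢a , ≢-sym e≢b

  insert₂ : CanInsert 2
  insert₂ = let (w , a≢w , b≢w) = third in canInsert (unique₃ a≢b a≢w b≢w) ≤-refl

  module _ {t : ℕ} (k≡ : blocks ≡ suc (suc t)) where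

    last-mixed : ∀ c d → Hamiltonian (embed (suc t) (lower , c)) (embed (suc t) (upper , d))
    last-mixed c d with d ≟ b | d ≟ a
    ... | yes refl | _ = last-mixed-to-b k≡ c
    ... | no _ | yes refl = BA.last-mixed-to-b k≡ c
    ... | no d≢b | no d≢a = last-mixed-avoiding k≡ insert₂ c d≢a d≢b

    -- The only place where the second edge is used as an edge rather than as a supply of vertices.
    last-lower : ∀ {c d} → c ≢ d → Hamiltonian (embed (suc t) (lower , c)) (embed (suc t) (lower , d))
    last-lower c≢d with e ≟ a | e ≟ b | f ≟ a | f ≟ b
    ... | yes refl | _ | _ | _ = BA.last-lower-adjacent k≡ insert₂ ef (λ b≡f → distinct (inj₁ (refl , b≡f))) c≢d
    ... | no _ | yes refl | _ | _ = last-lower-adjacent k≡ insert₂ ef (λ a≡f → distinct (inj₂ (a≡f , refl))) c≢d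
    ... | no e≢a | no _ | yes refl | _ = BA.last-lower-adjacent k≡ insert₂ (sym H ef) (λ b≡e → distinct (inj₂ (refl , b≡e))) c≢d
    ... | no _ | no e≢b | no _ | yes refl = last-lower-adjacent k≡ insert₂ (sym H ef) (λ a≡e → distinct (inj₁ (a≡e , refl))) c≢d
    ... | no e≢a | no e≢b | no f≢a | no f≢b =
      last-lower-disjoint k≡ insert₂ insert₃ ef (≢-sym e≢a) (≢-sym f≢a) (≢-sym e≢b) (≢-sym f≢b) c≢d
      where
      insert₃ : CanInsert 3
      insert₃ = canInsert (unique₄ a≢b (≢-sym e≢a) (≢-sym f≢a) (≢-sym e≢b) (≢-sym f≢b) e≢f) ≤-refl

  private
    last-block : ∀ {p} → blocks ≡ suc p + suc zero → blocks ≡ suc (suc p)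
    last-block {p} k≡ = trans k≡ (cong suc (+-comm p 1))

    middle-block : ∀ {p t} → blocks ≡ suc p + suc (suc t) → blocks ≡ suc (suc p) + suc t
    middle-block {p} {t} k≡ = trans k≡ (cong suc (+-suc p (suc t)))

  lower-pair : 2 ≤ blocks → ∀ {p} → p < blocks → ∀ {c d} → c ≢ d → Hamiltonian (embed p (lower , c)) (embed p (lower , d))
  lower-pair 2≤k {zero} _ c≢d = let (t , 2+t≡k) = m≤n⇒∃[o]m+o≡n 2≤k in first-lower t (≡.sym 2+t≡k) c≢d
  lower-pair _ {suc p} p+1<k c≢d with mirror-block L p+1<k
  ... | zero , k≡ = last-lower (last-block k≡) c≢d
  ... | suc t , k≡ = middle-lower (middle-block k≡) insert₂ c≢d

  mixed-pair : ∀ {p} → suc p < blocks → ∀ c d → Hamiltonian (embed (suc p) (lower , c)) (embed (suc p) (upper , d))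
  mixed-pair p+1<k with mirror-block L p+1<k
  ... | zero , k≡ = last-mixed (last-block k≡)
  ... | suc t , k≡ = middle-mixed (middle-block k≡)

module _ {A : Set} where

  nth : List A → A → ℕ → A
  nth [] z _ = z
  nth (x ∷ xs) z zero = x
  nth (x ∷ xs) z (suc i) = nth xs z i

  nth-∈ : ∀ xs z {i} → i < length xs → nth xs z i ∈ xs
  nth-∈ (x ∷ xs) z {zero} _ = here refl
  nth-∈ (x ∷ xs) z {suc i} (s≤s i<n) = there (nth-∈ xs z i<n)

  nth-injective : ∀ {xs} z → Unique xs → ∀ {i j} → i < length xs → j < length xs → nth xs z i ≡ nth xs z j → i ≡ j
  nth-injective {x ∷ xs} z u {zero} {zero} _ _ _ = refl
  nth-injective {x ∷ xs} z u {zero} {suc j} _ (s≤s j<n) x≡ =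
    contradiction (≡.subst (_∈ xs) (≡.sym x≡) (nth-∈ xs z j<n)) (Unique[x∷xs]⇒x∉xs u)
  nth-injective {x ∷ xs} z u {suc i} {zero} (s≤s i<n) _ ≡x =
    contradiction (≡.subst (_∈ xs) ≡x (nth-∈ xs z i<n)) (Unique[x∷xs]⇒x∉xs u)
  nth-injective {x ∷ xs} z (_ ∷ u) {suc i} {suc j} (s≤s i<n) (s≤s j<n) e = cong suc (nth-injective z u i<n j<n e)

  nth-surjective : ∀ {xs} z {x} → x ∈ xs → ∃ λ i → i < length xs × nth xs z i ≡ x
  nth-surjective z (here refl) = zero , s≤s z≤n , refl
  nth-surjective z (there x∈) = let (i , i<n , e) = nth-surjective z x∈ in suc i , s≤s i<n , e

module _ {V : Set} {G : Graph V} where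

  Walk-nth : ∀ {xs} → Walk G xs → ∀ z {i} → suc i < length xs → Adj G (nth xs z i) (nth xs z (suc i))
  Walk-nth (one _) z (s≤s ())
  Walk-nth (cons e _) z {zero} _ = e
  Walk-nth (cons _ w) z {suc i} (s≤s i+1<n) = Walk-nth w z i+1<n

module _ {n m : ℕ} {G : FinGraph n} (H : FinGraph m) where
  open LexProduct G H

  layering : ∀ {xs} → IsHamPath G xs → Fin n → ∀ k → n ≡ 2 * k → Layering
  layering {xs} (walk , unique , complete) z k n≡2k = record
    { blocks = k
    ; layer = nth xs z
    ; layer-adjacent = λ i i+1<2k → Walk-nth walk z (≡.subst (suc i <_) 2k≡|xs| i+1<2k)
    ; layer-injective = λ i<2k j<2k → nth-injective z unique (≡.subst (_ <_) 2k≡|xs| i<2k) (≡.subst (_ <_) 2k≡|xs| j<2k)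
    ; layer-surjective = λ g → let (i , i<n , e) = nth-surjective z (complete g) in i , ≡.subst (i <_) (≡.sym 2k≡|xs|) i<n , e
    }
    where
    2k≡|xs| : double k ≡ length xs
    2k≡|xs| = trans (double≡2* k) (trans (≡.sym n≡2k) (≡.sym (enumeration-length (enumeration⁺ unique complete))))

module _ {n m : ℕ} {G : FinGraph n} {H : FinGraph m} (L : LexProduct.Layering G H) where
  open LexProduct G H
  open Layered L

  one-block-pairs : blocks ≡ 1 → ∀ {a b} → Adj H a b → ∀ {p} → p < blocks → PairsWithin p
  one-block-pairs k≡1 ab {zero} _ = record
    { lower-lower = lone-lower k≡1
    ; upper-upper = λ c≢d → Hamiltonian-unreverse L k≡1 (R.lone-lower k≡1 c≢d)
    ; lower-upper = lone-mixed k≡1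
    }
    where
    open OneSided L ab
    module R = OneSided (reverseLayering L) ab
  one-block-pairs k≡1 ab {suc p} p+1<k = contradiction (≡.subst (suc p <_) k≡1 p+1<k) λ { (s≤s ()) }

  many-block-pairs : 2 ≤ blocks → ∀ {a b e f} → Adj H a b → Adj H e f → ¬ SameEdge a b e f →
                     ∀ {p} → p < blocks → PairsWithin p
  many-block-pairs 2≤k ab ef distinct {p} p<k = record
    { lower-lower = S.lower-pair 2≤k p<k
    ; upper-upper = λ c≢d → Hamiltonian-unreverse L k≡ (RS.lower-pair 2≤k q<k c≢d)
    ; lower-upper = lower-upper p p<k
    }
    where
    module S = SameBlock L ab ef distinct
    module RS = SameBlock (reverseLayering L) ab ef distinct
    q = proj₁ (mirror-block L p<k)
    k≡ = proj₂ (mirror-block L p<k)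
    q<k : q < blocks
    q<k = ≡.subst (q <_) (≡.sym k≡) (m≤n+m (suc q) p)
    lower-upper : ∀ p → p < blocks → ∀ c d → Hamiltonian (embed p (lower , c)) (embed p (upper , d))
    lower-upper zero 0<k c d with mirror-block L 0<k
    ... | zero , refl = contradiction 2≤k λ { (s≤s ()) }
    ... | suc t , k≡′ =
      Hamiltonian-unreverse L k≡′ {lower} {upper} (Layered.Traversal-reverse (reverseLayering L) (RS.last-mixed k≡′ d c))
    lower-upper (suc p) p+1<k = S.mixed-pair p+1<k

  hamConnected : ∀ {a b} → Adj H a b → (∀ {p} → p < blocks → PairsWithin p) → HamConnected (lex G H)
  hamConnected ab pairs u v u≢v = Hamiltonian⇒IsHamPath (TwoSided.connected L ab pairs u v u≢v)

corollary3 : ∀ (n m : ℕ) (G : FinGraph n) (H : FinGraph m) →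
    2 ≤ n → HasHamPath G →
    ((n ≡ 2 → AtLeast1Edge H → HamConnected (lex G H)) ×
     (∀ (k : ℕ) → 1 < k → n ≡ 2 * k → AtLeast2Edges H → HamConnected (lex G H)))
corollary3 (suc zero) _ _ _ (s≤s ()) _
corollary3 (suc (suc n)) m G H _ (_ , ham) = two-layers , many-layers
  where
  L : ∀ k → suc (suc n) ≡ 2 * k → LexProduct.Layering G H
  L = layering H ham 0F

  two-layers : suc (suc n) ≡ 2 → AtLeast1Edge H → HamConnected (lex G H)
  two-layers n≡2 (_ , _ , ab) = hamConnected (L 1 n≡2) ab (one-block-pairs (L 1 n≡2) refl ab)

  many-layers : ∀ k → 1 < k → suc (suc n) ≡ 2 * k → AtLeast2Edges H → HamConnected (lex G H)
  many-layers k 1<k n≡2k (_ , _ , _ , _ , ab , ef , distinct) =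
    hamConnected (L k n≡2k) ab (many-block-pairs (L k n≡2k) 1<k ab ef distinct)
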